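{- Let $G$ be a simplex graph and let $v_0$ be a vertex of $G$ such that every $\Theta$-class of $G$ contains an edge incident to $v_0$. Let $u,v$ be vertices of $G$ with $d(u,v)=\mathrm{ecc}(u)$. Then $v_0\in I(u,v)$.
   Context: A simplex graph is a graph $K(H)$ obtained from a graph $H$ by taking as vertices all vertex sets of cliques of $H$ (including the empty one), with $C,C'$ adjacent iff $C\subsetneq C'$ and $|C'|=|C|+1$. Two edges $xy,zw$ are in relation $\Theta_0$ if $x,y,w,z$ form a 4-cycle in which $xy$ and $zw$ are opposite edges; $\Theta$ is the reflexive-transitive closure of $\Theta_0$, and its equivalence classes are the $\Theta$-classes. $d$ is the shortest-path distance, $\mathrm{ecc}(u)=\max_w d(u,w)$, and $I(a,b)=\{w: d(a,w)+d(w,b)=d(a,b)\}$. -}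

module Defs where

open import Data.Nat using (ℕ; zero; suc; _+_; _≤_)
open import Data.Bool using (Bool; true; false; T; _∧_; _∨_; not)
open import Data.Fin using (Fin)
open import Data.Fin.Properties using (_≟_)
open import Data.Fin.Subset using (Subset; _⊂_; ∣_∣)
open import Data.Vec using (lookup)
open import Data.List.Base using (map; allFin)
open import Data.Bool.ListAction using (and)
open import Data.Product using (Σ; _×_; _,_; ∃; proj₁; proj₂)
open import Data.Sum using (_⊎_)
open import Relation.Nullary using (¬_)
open import Relation.Nullary.Decidable using (⌊_⌋)
open import Relation.Binary.PropositionalEquality using (_≡_; _≢_)
open import Relation.Binary.Construct.Closure.ReflexiveTransitive using (Star)

data Walk {V : Set} (E : V → V → Set) : V → V → ℕ → Set where
  here  : ∀ {x} → Walk E x x zero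
  there : ∀ {x y z k} → E x y → Walk E y z k → Walk E x z (suc k)

Dist : {V : Set} → (V → V → Set) → V → V → ℕ → Set
Dist E x y k = Walk E x y k × (∀ m → Walk E x y m → k ≤ m)

IsEccentric : {V : Set} → (V → V → Set) → V → V → Set
IsEccentric E u v = ∀ k → Dist E u v k → ∀ w m → Dist E u w m → m ≤ k

InInterval : {V : Set} → (V → V → Set) → V → V → V → Set
InInterval E a b w =
  ∀ p q r → Dist E a w p → Dist E w b q → Dist E a b r → p + q ≡ r

-- Edges (as ordered pairs; an unordered edge {x,y} appears as (x,y) and (y,x)).
Edge : {V : Set} → (V → V → Set) → Set
Edge {V} E = Σ (V × V) (λ p → E (proj₁ p) (proj₂ p))

-- Θ₀: xy and zw are opposite edges of a 4-cycle x - y - w - z - x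
-- (four distinct vertices).
Θ₀ : {V : Set} (E : V → V → Set) → Edge E → Edge E → Set
Θ₀ E ((x , y) , _) ((z , w) , _) =
  E y w × E z x × x ≢ y × x ≢ w × x ≢ z × y ≢ w × y ≢ z × w ≢ z

-- One step: a Θ₀ step, or reversing the orientation of the same edge.
ΘStep : {V : Set} (E : V → V → Set) → Edge E → Edge E → Set
ΘStep E e f = Θ₀ E e f ⊎ (proj₁ (proj₁ e) ≡ proj₂ (proj₁ f) × proj₂ (proj₁ e) ≡ proj₁ (proj₁ f))

Θ : {V : Set} (E : V → V → Set) → Edge E → Edge E → Set
Θ E = Star (ΘStep E)

EveryΘClassMeets : {V : Set} (E : V → V → Set) → V → Set
EveryΘClassMeets E v₀ = ∀ (e : Edge E) → ∃ λ z → Σ (E v₀ z) λ a → Θ E e ((v₀ , z) , a)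

isClique : ∀ {n} → (Fin n → Fin n → Bool) → Subset n → Bool
isClique {n} adj C =
  and (map (λ i → and (map (λ j → not (lookup C i ∧ lookup C j ∧ not ⌊ i ≟ j ⌋) ∨ adj i j)
                           (allFin n)))
           (allFin n))

KVertex : ∀ {n} → (Fin n → Fin n → Bool) → Set
KVertex {n} adj = Σ (Subset n) (λ C → T (isClique adj C))

KCover : ∀ {n} (adj : Fin n → Fin n → Bool) → KVertex adj → KVertex adj → Set
KCover adj (C , _) (C' , _) = C ⊂ C' × ∣ C' ∣ ≡ suc ∣ C ∣

KAdj : ∀ {n} (adj : Fin n → Fin n → Bool) → KVertex adj → KVertex adj → Set
KAdj adj x y = KCover adj x y ⊎ KCover adj y x

SimpleGraph : ∀ {n} → (Fin n → Fin n → Bool) → Set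
SimpleGraph {n} adj = (∀ i j → adj i j ≡ adj j i) × (∀ i → adj i i ≡ false)

module Submission where

-- A vertex of K(H) is a clique, i.e. a 0/1-vector indexed by V(H), and K(H) sits
-- isometrically in the hypercube: d(C, C′) = |C △ C′|, because one can always walk
-- towards C′ by first deleting the elements of C ∖ C′ and then adding those of C′ ∖ C.
-- Opposite edges of a square flip the same coordinate, so a Θ-class consists of edges
-- that all flip one vertex i of H.  Hence v₀ ∈ I(u,v) as soon as v₀ agrees with u
-- wherever u and v agree.  Let j be such a coordinate.  If j ∈ u ∩ v, deleting j from v
-- gives a vertex farther from u, contradicting d(u,v) = ecc(u).  If j ∉ u ∪ v but
-- j ∈ v₀, then for each i ∈ v the Θ-class flipping i has an edge at v₀, so v₀ or one of
-- its neighbours contains both i and j; thus v ∪ {j} is a clique, again farther from u.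

open import Data.Bool using (Bool; true; false; T; not; _∧_; _∨_)
open import Data.Bool.ListAction using (all)
open import Data.Bool.Properties using (¬-not; T-≡; T-irrelevant) renaming (_≟_ to _≟ᵇ_)
open import Data.Empty using (⊥-elim)
open import Data.Fin using (Fin; zero; suc)
open import Data.Fin.Properties using (_≟_; any?)
open import Data.Fin.Subset using (Subset; _∈_; _∉_; _⊆_; _⊂_; ∣_∣)
open import Data.Fin.Subset.Properties using (drop-∷-⊆; _∈?_)
open import Data.List.Base using (allFin)
open import Data.List.Relation.Unary.All.Properties using (all⁺; all⁻; tabulate⁺; tabulate⁻)
open import Data.Nat using (ℕ; zero; suc; _+_; _≤_; z≤n; s≤s)
open import Data.Nat.Properties
  using (+-comm; +-assoc; +-identityʳ; +-suc; +-cancelʳ-≡; +-mono-≤; suc-injective;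
         ≤-refl; ≤-reflexive; ≤-trans; ≤-antisym; <-irrefl; m≤n+m)
open import Data.Nat.Tactic.RingSolver using (solve-∀)
open import Data.Product using (_×_; _,_; ∃; proj₁)
open import Data.Sum using (_⊎_; inj₁; inj₂)
open import Data.Vec using (Vec; []; _∷_; lookup; _[_]≔_; here; there)
open import Data.Vec.Properties
  using (lookup∘update; lookup∘update′; []≔-lookup; []≔-updates; []=⇒lookup; lookup⇒[]=)
open import Data.Vec.Relation.Binary.Pointwise.Extensional using (ext; Pointwise-≡⇒≡)
open import Function using (_∘_; _⇔_; mk⇔; Equivalence)
open import Relation.Binary.Construct.Closure.ReflexiveTransitive using (ε; _◅_)
open import Relation.Binary.PropositionalEquality
open import Relation.Nullary using (¬_; Dec; yes; no; contradiction; ¬?; _×-dec_)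
open import Relation.Nullary.Decidable using (⌊_⌋)
open import Defs

private
  variable
    n k : ℕ

boolDistance : Bool → Bool → ℕ
boolDistance true  true  = 0
boolDistance false false = 0
boolDistance true  false = 1
boolDistance false true  = 1

hamming : Vec Bool n → Vec Bool n → ℕ
hamming []      []      = 0
hamming (a ∷ x) (b ∷ y) = boolDistance a b + hamming x y

boolDistance-sym : ∀ a b → boolDistance a b ≡ boolDistance b a
boolDistance-sym true  true  = refl
boolDistance-sym true  false = refl
boolDistance-sym false true  = refl
boolDistance-sym false false = refl

boolDistance-refl : ∀ a → boolDistance a a ≡ 0
boolDistance-refl true  = refl
boolDistance-refl false = refl

boolDistance-≢ : ∀ {a b} → a ≢ b → boolDistance a b ≡ 1
boolDistance-≢ {true}  {false} _   = refl
boolDistance-≢ {false} {true}  _   = refl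
boolDistance-≢ {true}  {true}  a≢b = contradiction refl a≢b
boolDistance-≢ {false} {false} a≢b = contradiction refl a≢b

boolDistance-triangle : ∀ a b c → boolDistance a c ≤ boolDistance a b + boolDistance b c
boolDistance-triangle true  true  c     = ≤-refl
boolDistance-triangle false false c     = ≤-refl
boolDistance-triangle true  false true  = z≤n
boolDistance-triangle true  false false = ≤-refl
boolDistance-triangle false true  true  = ≤-refl
boolDistance-triangle false true  false = z≤n

hamming-sym : (x y : Vec Bool n) → hamming x y ≡ hamming y x
hamming-sym []      []      = refl
hamming-sym (a ∷ x) (b ∷ y) = cong₂ _+_ (boolDistance-sym a b) (hamming-sym x y)

hamming-refl : (x : Vec Bool n) → hamming x x ≡ 0
hamming-refl []      = refl
hamming-refl (a ∷ x) = cong₂ _+_ (boolDistance-refl a) (hamming-refl x)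

hamming≡0⇒≡ : (x y : Vec Bool n) → hamming x y ≡ 0 → x ≡ y
hamming≡0⇒≡ []          []          _  = refl
hamming≡0⇒≡ (true ∷ x)  (true ∷ y)  eq = cong (true ∷_) (hamming≡0⇒≡ x y eq)
hamming≡0⇒≡ (false ∷ x) (false ∷ y) eq = cong (false ∷_) (hamming≡0⇒≡ x y eq)

hamming-triangle : (x y z : Vec Bool n) → hamming x z ≤ hamming x y + hamming y z
hamming-triangle []      []      []      = z≤n
hamming-triangle (a ∷ x) (b ∷ y) (c ∷ z) = ≤-trans
  (+-mono-≤ (boolDistance-triangle a b c) (hamming-triangle x y z))
  (≤-reflexive (interchange (boolDistance a b) (boolDistance b c) (hamming x y) (hamming y z)))
  where
  interchange : ∀ a b c d → (a + b) + (c + d) ≡ (a + c) + (b + d)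
  interchange = solve-∀

boolDistance-not : ∀ a → boolDistance a (not a) ≡ 1
boolDistance-not true  = refl
boolDistance-not false = refl

boolDistance-between : ∀ a b c → (a ≡ c → b ≡ a) → boolDistance a b + boolDistance b c ≡ boolDistance a c
boolDistance-between true  true  c     _ = refl
boolDistance-between false false c     _ = refl
boolDistance-between true  false false _ = refl
boolDistance-between false true  true  _ = refl
boolDistance-between true  false true  h with () ← h refl
boolDistance-between false true  false h with () ← h refl

lookup-≢⇒1≤hamming : ∀ (x y : Vec Bool n) {j} → lookup x j ≢ lookup y j → 1 ≤ hamming x y
lookup-≢⇒1≤hamming (a ∷ x) (b ∷ y) {zero}  a≢b rewrite boolDistance-≢ a≢b = s≤s z≤n
lookup-≢⇒1≤hamming (a ∷ x) (b ∷ y) {suc j} ≢j  = ≤-trans (lookup-≢⇒1≤hamming x y ≢j) (m≤n+m _ _)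

lookup-≢²⇒2≤hamming : ∀ (x y : Vec Bool n) {i j} → i ≢ j →
  lookup x i ≢ lookup y i → lookup x j ≢ lookup y j → 2 ≤ hamming x y
lookup-≢²⇒2≤hamming (a ∷ x) (b ∷ y) {zero}  {zero}  i≢j _  _  = contradiction refl i≢j
lookup-≢²⇒2≤hamming (a ∷ x) (b ∷ y) {zero}  {suc j} _   ≢i ≢j rewrite boolDistance-≢ ≢i =
  s≤s (lookup-≢⇒1≤hamming x y ≢j)
lookup-≢²⇒2≤hamming (a ∷ x) (b ∷ y) {suc i} {zero}  _   ≢i ≢j rewrite boolDistance-≢ ≢j =
  s≤s (lookup-≢⇒1≤hamming x y ≢i)
lookup-≢²⇒2≤hamming (a ∷ x) (b ∷ y) {suc i} {suc j} i≢j ≢i ≢j =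
  ≤-trans (lookup-≢²⇒2≤hamming x y (i≢j ∘ cong suc) ≢i ≢j) (m≤n+m _ _)

hamming≡1⇒lookup-≡ : ∀ (x y : Vec Bool n) {i j} → hamming x y ≡ 1 → i ≢ j →
  lookup x j ≢ lookup y j → lookup x i ≡ lookup y i
hamming≡1⇒lookup-≡ x y {i} h i≢j ≢j with lookup x i ≟ᵇ lookup y i
... | yes ≡i = ≡i
... | no ≢i = contradiction (subst (2 ≤_) h (lookup-≢²⇒2≤hamming x y i≢j ≢i ≢j)) (<-irrefl refl)

hamming≡suc⇒lookup-≢ : ∀ (x y : Vec Bool n) → hamming x y ≡ suc k → ∃ λ j → lookup x j ≢ lookup y j
hamming≡suc⇒lookup-≢ []      []      ()
hamming≡suc⇒lookup-≢ (a ∷ x) (b ∷ y) h with a ≟ᵇ b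
... | no a≢b = zero , a≢b
... | yes refl with j , ≢j ← hamming≡suc⇒lookup-≢ x y (trans (cong (_+ hamming x y) (sym (boolDistance-refl a))) h)
  = suc j , ≢j

-- Both sides carry a boolDistance term so that no subtraction is needed.
hamming-[]≔ : ∀ (x y : Vec Bool n) j b {a c} → lookup x j ≡ a → lookup y j ≡ c →
  hamming x (y [ j ]≔ b) + boolDistance a c ≡ hamming x y + boolDistance a b
hamming-[]≔ (a ∷ x) (c ∷ y) zero    b refl refl = rotate (boolDistance a b) (hamming x y) (boolDistance a c)
  where
  rotate : ∀ p q r → (p + q) + r ≡ (r + q) + p
  rotate = solve-∀
hamming-[]≔ (a ∷ x) (c ∷ y) (suc j) b {a′} {c′} xj yj = begin
  boolDistance a c + hamming x (y [ j ]≔ b) + boolDistance a′ c′   ≡⟨ +-assoc (boolDistance a c) _ _ ⟩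
  boolDistance a c + (hamming x (y [ j ]≔ b) + boolDistance a′ c′) ≡⟨ cong (boolDistance a c +_) (hamming-[]≔ x y j b xj yj) ⟩
  boolDistance a c + (hamming x y + boolDistance a′ b)             ≡⟨ +-assoc (boolDistance a c) _ _ ⟨
  boolDistance a c + hamming x y + boolDistance a′ b               ∎
  where open ≡-Reasoning

hamming-[]≔-toward : ∀ (x y : Vec Bool n) {j b} → lookup x j ≡ b → lookup y j ≡ not b →
  suc (hamming x (y [ j ]≔ b)) ≡ hamming x y
hamming-[]≔-toward x y {j} {b} xj yj = begin
  suc (hamming x (y [ j ]≔ b))                  ≡⟨ +-comm 1 _ ⟩
  hamming x (y [ j ]≔ b) + 1                    ≡⟨ cong (hamming x (y [ j ]≔ b) +_) (boolDistance-not b) ⟨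
  hamming x (y [ j ]≔ b) + boolDistance b (not b) ≡⟨ hamming-[]≔ x y j b xj yj ⟩
  hamming x y + boolDistance b b                ≡⟨ cong (hamming x y +_) (boolDistance-refl b) ⟩
  hamming x y + 0                               ≡⟨ +-identityʳ _ ⟩
  hamming x y                                   ∎
  where open ≡-Reasoning

hamming-[]≔-away : ∀ (x y : Vec Bool n) {j b} → lookup x j ≡ b → lookup y j ≡ b →
  hamming x (y [ j ]≔ not b) ≡ suc (hamming x y)
hamming-[]≔-away x y {j} {b} xj yj = begin
  hamming x (y [ j ]≔ not b)                    ≡⟨ +-identityʳ _ ⟨
  hamming x (y [ j ]≔ not b) + 0                ≡⟨ cong (hamming x (y [ j ]≔ not b) +_) (boolDistance-refl b) ⟨
  hamming x (y [ j ]≔ not b) + boolDistance b b ≡⟨ hamming-[]≔ x y j (not b) xj yj ⟩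
  hamming x y + boolDistance b (not b)          ≡⟨ cong (hamming x y +_) (boolDistance-not b) ⟩
  hamming x y + 1                               ≡⟨ +-comm _ 1 ⟩
  suc (hamming x y)                             ∎
  where open ≡-Reasoning

hamming-⊆ : (p q : Subset n) → p ⊆ q → hamming p q + ∣ p ∣ ≡ ∣ q ∣
hamming-⊆ []          []          _   = refl
hamming-⊆ (true ∷ p)  (true ∷ q)  p⊆q = trans (+-suc _ _) (cong suc (hamming-⊆ p q (drop-∷-⊆ p⊆q)))
hamming-⊆ (false ∷ p) (true ∷ q)  p⊆q = cong suc (hamming-⊆ p q (drop-∷-⊆ p⊆q))
hamming-⊆ (false ∷ p) (false ∷ q) p⊆q = hamming-⊆ p q (drop-∷-⊆ p⊆q)
hamming-⊆ (true ∷ p)  (false ∷ q) p⊆q with () ← p⊆q here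

hamming-between : ∀ (x y z : Vec Bool n) → (∀ j → lookup x j ≡ lookup z j → lookup y j ≡ lookup x j) →
  hamming x y + hamming y z ≡ hamming x z
hamming-between []      []      []      _ = refl
hamming-between (a ∷ x) (b ∷ y) (c ∷ z) h = begin
  (boolDistance a b + hamming x y) + (boolDistance b c + hamming y z)
    ≡⟨ interchange (boolDistance a b) (hamming x y) (boolDistance b c) (hamming y z) ⟩
  (boolDistance a b + boolDistance b c) + (hamming x y + hamming y z)
    ≡⟨ cong₂ _+_ (boolDistance-between a b c (h zero)) (hamming-between x y z (h ∘ suc)) ⟩
  boolDistance a c + hamming x z ∎
  where
  open ≡-Reasoning
  interchange : ∀ p q r s → (p + q) + (r + s) ≡ (p + r) + (q + s)
  interchange = solve-∀

IsClique : (Fin n → Fin n → Bool) → Subset n → Set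
IsClique adj C = ∀ {i j} → lookup C i ≡ true → lookup C j ≡ true → i ≢ j → adj i j ≡ true

clique-entry : ∀ {P : Set} (p? : Dec P) a b d →
  T (not (a ∧ b ∧ not ⌊ p? ⌋) ∨ d) ⇔ (a ≡ true → b ≡ true → ¬ P → d ≡ true)
clique-entry p?      false b     d = mk⇔ (λ _ ()) _
clique-entry p?      true  false d = mk⇔ (λ _ _ ()) _
clique-entry (yes p) true  true  d = mk⇔ (λ _ _ _ ¬p → contradiction p ¬p) _
clique-entry (no ¬p) true  true  d = mk⇔ (λ t _ _ _ → Equivalence.to T-≡ t) (λ h → Equivalence.from T-≡ (h refl refl ¬p))

T-isClique : (adj : Fin n → Fin n → Bool) (C : Subset n) → T (isClique adj C) ⇔ IsClique adj C
T-isClique {n} adj C = mk⇔ to from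
  where
  entry : Fin n → Fin n → Bool
  entry i j = not (lookup C i ∧ lookup C j ∧ not ⌊ i ≟ j ⌋) ∨ adj i j

  to : T (isClique adj C) → IsClique adj C
  to t {i} {j} = Equivalence.to (clique-entry (i ≟ j) _ _ _)
    (tabulate⁻ (all⁺ (entry i) (allFin n) (tabulate⁻ (all⁺ (λ i → all (entry i) (allFin n)) (allFin n) t) i)) j)

  from : IsClique adj C → T (isClique adj C)
  from cl = all⁻ _ (tabulate⁺ λ i → all⁻ _ (tabulate⁺ λ j → Equivalence.from (clique-entry (i ≟ j) _ _ _) cl))

IsClique-anti-mono : ∀ {adj : Fin n → Fin n → Bool} {C D} → D ⊆ C → IsClique adj C → IsClique adj D
IsClique-anti-mono {C = C} {D} D⊆C cl di dj = cl (⊆-lookup di) (⊆-lookup dj)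
  where
  ⊆-lookup : ∀ {i} → lookup D i ≡ true → lookup C i ≡ true
  ⊆-lookup di = []=⇒lookup (D⊆C (lookup⇒[]= _ D di))

IsClique-[]≔true : ∀ {adj : Fin n → Fin n → Bool} → (∀ i j → adj i j ≡ adj j i) →
  ∀ {C j} → IsClique adj C → (∀ {i} → lookup C i ≡ true → i ≢ j → adj i j ≡ true) →
  IsClique adj (C [ j ]≔ true)
IsClique-[]≔true {adj = adj} adj-sym {C} {j} cl adj-j = clique
  where
  unchanged : ∀ {l} → l ≢ j → lookup (C [ j ]≔ true) l ≡ true → lookup C l ≡ true
  unchanged l≢j = trans (sym (lookup∘update′ l≢j C true))

  clique : IsClique adj (C [ j ]≔ true)
  clique {i} {k} ci ck i≢k with i ≟ j | k ≟ j
  ... | yes refl | yes refl = contradiction refl i≢k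
  ... | yes refl | no k≢j   = trans (adj-sym i k) (adj-j (unchanged k≢j ck) k≢j)
  ... | no i≢j   | yes refl = adj-j (unchanged i≢j ci) i≢j
  ... | no i≢j   | no k≢j   = cl (unchanged i≢j ci) (unchanged k≢j ck) i≢k

infix 4 _⋖_
_⋖_ : Subset n → Subset n → Set
C ⋖ D = C ⊂ D × ∣ D ∣ ≡ suc ∣ C ∣

∉[]≔false : ∀ (C : Subset n) j → j ∉ C [ j ]≔ false
∉[]≔false C j m with () ← trans (sym (lookup∘update j C false)) ([]=⇒lookup m)

∈-[]≔⁻ : ∀ (C : Subset n) {i j b} → i ≢ j → i ∈ C [ j ]≔ b → i ∈ C
∈-[]≔⁻ C {i} i≢j m = lookup⇒[]= i C (trans (sym (lookup∘update′ i≢j C _)) ([]=⇒lookup m))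

[]≔false-⊆ : ∀ (C : Subset n) j → C [ j ]≔ false ⊆ C
[]≔false-⊆ C j {i} m with i ≟ j
... | yes refl = contradiction m (∉[]≔false C j)
... | no i≢j   = ∈-[]≔⁻ C i≢j m

[]≔true-⊆ : ∀ {C D : Subset n} {j} → C ⊆ D → j ∈ D → C [ j ]≔ true ⊆ D
[]≔true-⊆ {C = C} {j = j} C⊆D j∈D {i} m with i ≟ j
... | yes refl = j∈D
... | no i≢j   = C⊆D (∈-[]≔⁻ C i≢j m)

[]≔false⊆[]≔true : ∀ (C : Subset n) j → C [ j ]≔ false ⊆ C [ j ]≔ true
[]≔false⊆[]≔true (c ∷ C) zero    (there m) = there m
[]≔false⊆[]≔true (c ∷ C) (suc j) here      = here
[]≔false⊆[]≔true (c ∷ C) (suc j) (there m) = there ([]≔false⊆[]≔true C j m)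

∣[]≔true∣ : ∀ (C : Subset n) j → ∣ C [ j ]≔ true ∣ ≡ suc ∣ C [ j ]≔ false ∣
∣[]≔true∣ (c     ∷ C) zero    = refl
∣[]≔true∣ (true  ∷ C) (suc j) = cong suc (∣[]≔true∣ C j)
∣[]≔true∣ (false ∷ C) (suc j) = ∣[]≔true∣ C j

[]≔false⋖[]≔true : ∀ (C : Subset n) j → C [ j ]≔ false ⋖ C [ j ]≔ true
[]≔false⋖[]≔true C j =
  ([]≔false⊆[]≔true C j , j , []≔-updates C j , ∉[]≔false C j) , ∣[]≔true∣ C j

[]≔-lookup′ : ∀ (C : Subset n) {j b} → lookup C j ≡ b → C [ j ]≔ b ≡ C
[]≔-lookup′ C {j} refl = []≔-lookup C j

∉⇒lookup≡false : ∀ (C : Subset n) {j} → j ∉ C → lookup C j ≡ false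
∉⇒lookup≡false C {j} j∉C = ¬-not (j∉C ∘ lookup⇒[]= j C)

[]≔false⋖ : ∀ (C : Subset n) {j} → j ∈ C → C [ j ]≔ false ⋖ C
[]≔false⋖ C {j} j∈C = subst (C [ j ]≔ false ⋖_) ([]≔-lookup′ C ([]=⇒lookup j∈C)) ([]≔false⋖[]≔true C j)

⋖[]≔true : ∀ (C : Subset n) {j} → j ∉ C → C ⋖ C [ j ]≔ true
⋖[]≔true C {j} j∉C = subst (_⋖ C [ j ]≔ true) ([]≔-lookup′ C (∉⇒lookup≡false C j∉C)) ([]≔false⋖[]≔true C j)

⋖⇒hamming≡1 : ∀ {C D : Subset n} → C ⋖ D → hamming C D ≡ 1
⋖⇒hamming≡1 {C = C} {D} ((C⊆D , _) , ∣D∣) = +-cancelʳ-≡ ∣ C ∣ _ _ (trans (hamming-⊆ C D C⊆D) ∣D∣)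

∃∈∉⊎⊆ : ∀ (C D : Subset n) → (∃ λ j → j ∈ C × j ∉ D) ⊎ C ⊆ D
∃∈∉⊎⊆ C D with any? (λ j → j ∈? C ×-dec ¬? (j ∈? D))
... | yes witness = inj₁ witness
... | no ∄        = inj₂ C⊆D
  where
  C⊆D : C ⊆ D
  C⊆D {i} i∈C with i ∈? D
  ... | yes i∈D = i∈D
  ... | no i∉D  = contradiction (i , i∈C , i∉D) ∄

⊆-hamming≡suc⇒∃∈∉ : ∀ {C D : Subset n} → C ⊆ D → hamming D C ≡ suc k → ∃ λ j → j ∈ D × j ∉ C
⊆-hamming≡suc⇒∃∈∉ {C = C} {D} C⊆D h with j , D≢C ← hamming≡suc⇒lookup-≢ D C h | j ∈? C
... | yes j∈C = contradiction (trans ([]=⇒lookup (C⊆D j∈C)) (sym ([]=⇒lookup j∈C))) D≢C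
... | no j∉C  = j , lookup⇒[]= j D (trans (¬-not D≢C) (cong not (∉⇒lookup≡false C j∉C))) , j∉C

module HypercubeEmbedding {V : Set} (E : V → V → Set) (code : V → Vec Bool n)
  (code-injective : ∀ {x y} → code x ≡ code y → x ≡ y)
  (E⇒hamming≡1 : ∀ {x y} → E x y → hamming (code x) (code y) ≡ 1) where

  Flips : Fin n → Edge E → Set
  Flips j ((x , y) , _) = lookup (code x) j ≢ lookup (code y) j

  E-flips-only : ∀ {x y i j} → E x y → i ≢ j →
    lookup (code x) j ≢ lookup (code y) j → lookup (code x) i ≡ lookup (code y) i
  E-flips-only {x} {y} exy = hamming≡1⇒lookup-≡ (code x) (code y) (E⇒hamming≡1 exy)

  flip-flip⇒≡ : ∀ {x y z j} → E x y → E y z →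
    lookup (code x) j ≢ lookup (code y) j → lookup (code y) j ≢ lookup (code z) j → x ≡ z
  flip-flip⇒≡ {x} {y} {z} {j} exy eyz x≢y y≢z = code-injective (Pointwise-≡⇒≡ (ext agree))
    where
    agree : ∀ i → lookup (code x) i ≡ lookup (code z) i
    agree i with i ≟ j
    ... | yes refl = trans (¬-not x≢y) (sym (¬-not (y≢z ∘ sym)))
    ... | no i≢j   = trans (E-flips-only exy i≢j x≢y) (E-flips-only eyz i≢j y≢z)

  -- If zw did not flip j, the square would have two consecutive edges flipping j,
  -- which would identify two of its distinct vertices.
  ΘStep-Flips : ∀ {j e f} → ΘStep E e f → Flips j e → Flips j f
  ΘStep-Flips (inj₂ (refl , refl)) x≢y = x≢y ∘ sym
  ΘStep-Flips {j} {(x , y) , exy} {(z , w) , _} (inj₁ (eyw , ezx , _ , x≢w , _ , _ , y≢z , _)) x≢y z≡w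
    with lookup (code y) j ≟ᵇ lookup (code w) j
  ... | no y≢w  = x≢w (flip-flip⇒≡ exy eyw x≢y y≢w)
  ... | yes y≡w = y≢z (sym (flip-flip⇒≡ ezx exy z≢x x≢y))
    where
    z≢x : lookup (code z) j ≢ lookup (code x) j
    z≢x z≡x = x≢y (trans (sym z≡x) (trans z≡w (sym y≡w)))

  Θ-Flips : ∀ {j e f} → Θ E e f → Flips j e → Flips j f
  Θ-Flips ε        flips = flips
  Θ-Flips {j} {e} (_◅_ {j = e′} s ss) flips = Θ-Flips ss (ΘStep-Flips {j} {e} {e′} s flips)

  EveryΘClassMeets⇒Flips : ∀ {w} → EveryΘClassMeets E w → ∀ {i} e → Flips i e →
    ∃ λ z → E w z × lookup (code w) i ≢ lookup (code z) i
  EveryΘClassMeets⇒Flips meets {i} e flips with z , ewz , e~wz ← meets e = z , ewz , Θ-Flips {i} {e} e~wz flips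

  hamming≤length : ∀ {x y k} → Walk E x y k → hamming (code x) (code y) ≤ k
  hamming≤length {x} here = ≤-reflexive (hamming-refl (code x))
  hamming≤length {x} (there {y = y} {z = z} exy w) = ≤-trans
    (hamming-triangle (code x) (code y) (code z))
    (subst (λ d → d + hamming (code y) (code z) ≤ _) (sym (E⇒hamming≡1 exy)) (s≤s (hamming≤length w)))

  module Isometric
    (step-toward : ∀ x y {k} → hamming (code y) (code x) ≡ suc k →
                   ∃ λ x′ → E x x′ × hamming (code y) (code x′) ≡ k) where

    walk-toward : ∀ k x y → hamming (code y) (code x) ≡ k → Walk E x y k
    walk-toward zero x y h = subst (λ z → Walk E x z zero) x≡y here
      where
      x≡y : x ≡ y
      x≡y = code-injective (hamming≡0⇒≡ (code x) (code y) (trans (hamming-sym (code x) (code y)) h))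
    walk-toward (suc k) x y h with x′ , exx′ , h′ ← step-toward x y h = there exx′ (walk-toward k x′ y h′)

    Dist-hamming : ∀ x y → Dist E x y (hamming (code x) (code y))
    Dist-hamming x y = walk-toward _ x y (hamming-sym (code y) (code x)) , λ _ → hamming≤length

    Dist⇒≡hamming : ∀ {x y k} → Dist E x y k → k ≡ hamming (code x) (code y)
    Dist⇒≡hamming {x} {y} (w , minimal) = ≤-antisym (minimal _ (proj₁ (Dist-hamming x y))) (hamming≤length w)

    eccentric⇒hamming-maximal : ∀ {u v} → IsEccentric E u v →
      ∀ w → hamming (code u) (code w) ≤ hamming (code u) (code v)
    eccentric⇒hamming-maximal {u} {v} ecc w = ecc _ (Dist-hamming u v) w _ (Dist-hamming u w)

module SimplexGraph (adj : Fin n → Fin n → Bool) (adj-sym : ∀ i j → adj i j ≡ adj j i) where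

  code : KVertex adj → Subset n
  code = proj₁

  code-injective : ∀ {x y} → code x ≡ code y → x ≡ y
  code-injective {C , p} {.C , q} refl = cong (C ,_) (T-irrelevant p q)

  KAdj⇒hamming≡1 : ∀ {x y} → KAdj adj x y → hamming (code x) (code y) ≡ 1
  KAdj⇒hamming≡1 (inj₁ x⋖y) = ⋖⇒hamming≡1 x⋖y
  KAdj⇒hamming≡1 {x} {y} (inj₂ y⋖x) = trans (hamming-sym (code x) (code y)) (⋖⇒hamming≡1 y⋖x)

  clique : (x : KVertex adj) → IsClique adj (code x)
  clique (C , t) = Equivalence.to (T-isClique adj C) t

  vertex : (C : Subset n) → IsClique adj C → KVertex adj
  vertex C cl = C , Equivalence.from (T-isClique adj C) cl

  removal : KVertex adj → Fin n → KVertex adj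
  removal x j = vertex (code x [ j ]≔ false) (IsClique-anti-mono ([]≔false-⊆ (code x) j) (clique x))

  open HypercubeEmbedding (KAdj adj) code code-injective (λ {x} {y} → KAdj⇒hamming≡1 {x} {y}) public

  removal-edge : ∀ v {i} → lookup (code v) i ≡ true → Edge (KAdj adj)
  removal-edge v {i} vi = (removal v i , v) , inj₁ ([]≔false⋖ (code v) (lookup⇒[]= i (code v) vi))

  removal-edge-Flips : ∀ v {i} (vi : lookup (code v) i ≡ true) → Flips i (removal-edge v vi)
  removal-edge-Flips v {i} vi v⁻i≡v = ∉[]≔false (code v) i (lookup⇒[]= i _ (trans v⁻i≡v vi))

  step-toward : ∀ x y {k} → hamming (code y) (code x) ≡ suc k →
                ∃ λ x′ → KAdj adj x x′ × hamming (code y) (code x′) ≡ k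
  step-toward x@(X , _) y@(Y , _) h with ∃∈∉⊎⊆ X Y
  ... | inj₁ (j , j∈X , j∉Y) =
    removal x j , inj₂ ([]≔false⋖ X j∈X) ,
    suc-injective (trans (hamming-[]≔-toward Y X (∉⇒lookup≡false Y j∉Y) ([]=⇒lookup j∈X)) h)
  ... | inj₂ X⊆Y with j , j∈Y , j∉X ← ⊆-hamming≡suc⇒∃∈∉ X⊆Y h =
    vertex (X [ j ]≔ true) (IsClique-anti-mono ([]≔true-⊆ X⊆Y j∈Y) (clique y)) , inj₁ (⋖[]≔true X j∉X) ,
    suc-injective (trans (hamming-[]≔-toward Y X ([]=⇒lookup j∈Y) (∉⇒lookup≡false X j∉X)) h)

  open Isometric step-toward public

  eccentric⇒¬IsClique-flip : ∀ {u v j b} → IsEccentric (KAdj adj) u v →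
    lookup (code u) j ≡ b → lookup (code v) j ≡ b → ¬ IsClique adj (code v [ j ]≔ not b)
  eccentric⇒¬IsClique-flip {u} {v} {j} {b} ecc uj vj cl = <-irrefl refl
    (subst (_≤ hamming (code u) (code v)) (hamming-[]≔-away (code u) (code v) uj vj)
      (eccentric⇒hamming-maximal ecc (vertex (code v [ j ]≔ not b) cl)))

  EveryΘClassMeets⇒IsClique-[]≔true : ∀ {w j} → EveryΘClassMeets (KAdj adj) w →
    lookup (code w) j ≡ true → ∀ v → IsClique adj (code v [ j ]≔ true)
  EveryΘClassMeets⇒IsClique-[]≔true {w} {j} meets wj v = IsClique-[]≔true adj-sym {code v} (clique v) adj-j
    where
    adj-j : ∀ {i} → lookup (code v) i ≡ true → i ≢ j → adj i j ≡ true
    adj-j {i} vi i≢j with lookup (code w) i ≟ᵇ true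
    ... | yes wi = clique w wi wj i≢j
    ... | no wi≢true
      with z , wz , w≢z ← EveryΘClassMeets⇒Flips meets (removal-edge v vi) (removal-edge-Flips v vi)
      = clique z (trans (¬-not (w≢z ∘ sym)) (cong not (¬-not wi≢true)))
                 (trans (sym (E-flips-only {w} {z} wz (i≢j ∘ sym) w≢z)) wj) i≢j

  eccentric⇒agreement : ∀ {u v w} → IsEccentric (KAdj adj) u v → EveryΘClassMeets (KAdj adj) w →
    ∀ j → lookup (code u) j ≡ lookup (code v) j → lookup (code w) j ≡ lookup (code u) j
  eccentric⇒agreement {u} {v} {w} ecc meets j u≡v with lookup (code u) j in uj | lookup (code w) j in wj
  ... | true  | _     = ⊥-elim (eccentric⇒¬IsClique-flip ecc uj (sym u≡v)
                                 (IsClique-anti-mono ([]≔false-⊆ (code v) j) (clique v)))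
  ... | false | false = refl
  ... | false | true  = ⊥-elim (eccentric⇒¬IsClique-flip ecc uj (sym u≡v)
                                 (EveryΘClassMeets⇒IsClique-[]≔true meets wj v))

lemma13 : (n : ℕ) (adj : Fin n → Fin n → Bool) → SimpleGraph adj →
    (v₀ : KVertex adj) → EveryΘClassMeets (KAdj adj) v₀ →
    (u v : KVertex adj) → IsEccentric (KAdj adj) u v →
    InInterval (KAdj adj) u v v₀
lemma13 n adj (adj-sym , _) v₀ meets u v ecc p q r d₁ d₂ d₃ = begin
  p + q
    ≡⟨ cong₂ _+_ (Dist⇒≡hamming d₁) (Dist⇒≡hamming d₂) ⟩
  hamming (code u) (code v₀) + hamming (code v₀) (code v)
    ≡⟨ hamming-between (code u) (code v₀) (code v) (eccentric⇒agreement ecc meets) ⟩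
  hamming (code u) (code v)
    ≡⟨ Dist⇒≡hamming d₃ ⟨
  r ∎
  where
  open SimplexGraph adj adj-sym
  open ≡-Reasoning
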